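{- Let $E_1$ and $E_2$ be two uniform evaluators $XYZ$, $X'Y'Z'$ (as described in the context) that differ in strictness, i.e. $Y\neq Y'$. Then neither absorbs the other: $E_2\circ E_1\neq E_2$ and $E_1\circ E_2\neq E_1$ as partial functions on $\lambda$-terms.
   Context: Terms: $\Lambda ::= x\mid \lambda x.\Lambda\mid \Lambda\Lambda$ (modulo $\alpha$); $[N/x]B$ is capture-avoiding substitution. An evaluator is a partial function $\Lambda\rightharpoonup\Lambda$ (undefined = divergence); $\mathrm{id}$ is the identity; $(E_2\circ E_1)(M)=E_2(E_1(M))$, undefined if $E_1(M)$ is undefined. $E_2$ absorbs $E_1$ iff $E_2\circ E_1=E_2$. Eval-apply template: $E$ is the least partial function with $E(x)=x$; $E(\lambda x.B)=\lambda x.\mathit{la}(B)$; for $E(MN)$: compute $M'=\mathit{op}_1(M)$; if $M'\equiv\lambda x.B$, compute $N'=\mathit{ar}_1(N)$ and return $E([N'/x]B)$; otherwise compute $M''=\mathit{op}_2(M')$, then $N'=\mathit{ar}_2(N)$, and return $M''N'$ (in this order; divergence propagates). For a triple $XYZ$ with $X,Y,Z\in\{\mathsf I,\mathsf S\}$, the uniform evaluator $XYZ$ is the instance with $\mathit{op}_1=E$, $\mathit{op}_2=\mathrm{id}$, and $\mathit{la},\mathit{ar}_1,\mathit{ar}_2$ given respectively by $X,Y,Z$, where $\mathsf I$ means $\mathrm{id}$ and $\mathsf S$ means $E$ itself. The evaluator is strict when its middle letter is $\mathsf S$ and non-strict when it is $\mathsf I$. -}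

module Defs where

open import Data.Nat using (ℕ; zero; suc; _+_)
open import Data.Product using (Σ; _×_; _,_)
open import Function.Bundles using (_⇔_)

-- λ-terms modulo α, as de Bruijn terms (open terms allowed: free
-- variables are indices exceeding the number of enclosing binders).
data Term : Set where
  var : ℕ → Term
  lam : Term → Term
  app : Term → Term → Term

-- shift c d t : add d to every variable of t with index ≥ c (cutoff c)
shiftVar : ℕ → ℕ → ℕ → ℕ
shiftVar zero    d i       = d + i
shiftVar (suc c) d zero    = zero
shiftVar (suc c) d (suc i) = suc (shiftVar c d i)

shift : ℕ → ℕ → Term → Term
shift c d (var i)   = var (shiftVar c d i)
shift c d (lam t)   = lam (shift (suc c) d t)
shift c d (app t u) = app (shift c d t) (shift c d u)

-- substVar k N i : the result of substituting N for variable k (seen under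
-- k binders) in variable i: indices below k stay, index k becomes N
-- (shifted by k), indices above k are decremented (the binder disappears).
substVar : ℕ → Term → ℕ → Term
substVar zero    N zero    = N
substVar zero    N (suc i) = var i
substVar (suc k) N zero    = var zero
substVar (suc k) N (suc i) = shift 0 1 (substVar k N i)

substAt : ℕ → Term → Term → Term
substAt k N (var i)   = substVar k N i
substAt k N (lam t)   = lam (substAt (suc k) N t)
substAt k N (app t u) = app (substAt k N t) (substAt k N u)

-- [N/x]B where B is the body of λx.B (x = index 0): capture-avoiding
subst : Term → Term → Term
subst B N = substAt 0 N B

-- Letters: I = identity, S = the evaluator itself
data Letter : Set where
  I S : Letter

record Uniform : Set where
  constructor ⟨_,_,_⟩
  field
    la ar₁ ar₂ : Letter
open Uniform public

data NotLam : Term → Set where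
  nl-var : ∀ {i} → NotLam (var i)
  nl-app : ∀ {M N} → NotLam (app M N)

-- Big-step graph of the uniform evaluator E = XYZ (least fixed point of
-- the eval-apply template, op₁ = E, op₂ = id).  Ev E M V means E(M) = V.
mutual
  data Ev (E : Uniform) : Term → Term → Set where
    ev-var : ∀ {i} → Ev E (var i) (var i)
    ev-lam : ∀ {B B'} → Via E (la E) B B' → Ev E (lam B) (lam B')
    ev-β   : ∀ {M N B N' V} → Ev E M (lam B) → Via E (ar₁ E) N N' →
             Ev E (subst B N') V → Ev E (app M N) V
    ev-app : ∀ {M N M' N'} → Ev E M M' → NotLam M' → Via E (ar₂ E) N N' →
             Ev E (app M N) (app M' N')

  data Via (E : Uniform) : Letter → Term → Term → Set where
    via-I : ∀ {M} → Via E I M M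
    via-S : ∀ {M M'} → Ev E M M' → Via E S M M'

Comp : Uniform → Uniform → Term → Term → Set
Comp E₂ E₁ M V = Σ Term λ M' → Ev E₁ M M' × Ev E₂ M' V

Absorbs : Uniform → Uniform → Set
Absorbs E₂ E₁ = ∀ M V → Comp E₂ E₁ M V ⇔ Ev E₂ M V

-- A strict evaluator must evaluate the argument of a β-redex, a non-strict
-- one may discard it.  On (λy. x) Ω, where Ω = (λz. z z)(λz. z z) diverges
-- under every uniform evaluator, a non-strict evaluator returns x while a
-- strict one diverges.  Since x evaluates to itself, composing in either
-- order changes where the outer evaluator is defined.
module Submission where

open import Defs
open import Data.Product using (_×_; _,_)
open import Data.Empty using (⊥-elim)
open import Relation.Nullary using (¬_)
open import Relation.Binary.PropositionalEquality using (_≢_; _≡_; refl)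
open import Function.Bundles using (Equivalence)

Diverges : Uniform → Term → Set
Diverges E M = ∀ {V} → ¬ Ev E M V

¬Absorbs-if-absorbed-diverges : ∀ {E₂ E₁ M V} →
  Ev E₂ M V → Diverges E₁ M → ¬ Absorbs E₂ E₁
¬Absorbs-if-absorbed-diverges {M = M} {V} E₂M⇓V E₁M⇑ absorbs
  with Equivalence.from (absorbs M V) E₂M⇓V
... | _ , E₁M⇓ , _ = E₁M⇑ E₁M⇓

¬Absorbs-if-absorber-diverges : ∀ {E₂ E₁ M V W} →
  Ev E₁ M V → Ev E₂ V W → Diverges E₂ M → ¬ Absorbs E₂ E₁
¬Absorbs-if-absorber-diverges {M = M} {V} {W} E₁M⇓V E₂V⇓W E₂M⇑ absorbs =
  E₂M⇑ (Equivalence.to (absorbs M W) (V , E₁M⇓V , E₂V⇓W))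

ω : Term
ω = lam (app (var 0) (var 0))

Ω : Term
Ω = app ω ω

ev-self-app : ∀ {E V} → Ev E (app (var 0) (var 0)) V → V ≡ app (var 0) (var 0)
ev-self-app (ev-β () _ _)
ev-self-app (ev-app ev-var _ via-I)          = refl
ev-self-app (ev-app ev-var _ (via-S ev-var)) = refl

ev-ω : ∀ {E V} → Ev E ω V → V ≡ ω
ev-ω (ev-lam via-I) = refl
ev-ω (ev-lam (via-S body⇓)) with ev-self-app body⇓
... | refl = refl

via-ω : ∀ {E L V} → Via E L ω V → V ≡ ω
via-ω via-I      = refl
via-ω (via-S ω⇓) = ev-ω ω⇓

-- Any derivation for Ω contains a strictly smaller one for Ω again.
Ω-diverges : ∀ {E} → Diverges E Ω
Ω-diverges (ev-β ω⇓ ω↦ body⇓) with ev-ω ω⇓ | via-ω ω↦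
... | refl | refl = Ω-diverges body⇓
Ω-diverges (ev-app ω⇓ notLam _) with ev-ω ω⇓
Ω-diverges (ev-app _ () _) | refl

-- (λy. x) Ω, with x the free variable 0
discard-Ω : Term
discard-Ω = app (lam (var 1)) Ω

nonstrict-discards-Ω : ∀ X Z → Ev ⟨ X , I , Z ⟩ discard-Ω (var 0)
nonstrict-discards-Ω I Z = ev-β (ev-lam via-I) via-I ev-var
nonstrict-discards-Ω S Z = ev-β (ev-lam (via-S ev-var)) via-I ev-var

strict-diverges-on-discard-Ω : ∀ X Z → Diverges ⟨ X , S , Z ⟩ discard-Ω
strict-diverges-on-discard-Ω X Z (ev-β _ (via-S Ω⇓) _) = Ω-diverges Ω⇓
strict-diverges-on-discard-Ω X Z (ev-app (ev-lam _) () _)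

nonstrict-¬Absorbs-strict : ∀ X Z X' Z' → ¬ Absorbs ⟨ X' , I , Z' ⟩ ⟨ X , S , Z ⟩
nonstrict-¬Absorbs-strict X Z X' Z' =
  ¬Absorbs-if-absorbed-diverges (nonstrict-discards-Ω X' Z')
                                (strict-diverges-on-discard-Ω X Z)

strict-¬Absorbs-nonstrict : ∀ X Z X' Z' → ¬ Absorbs ⟨ X , S , Z ⟩ ⟨ X' , I , Z' ⟩
strict-¬Absorbs-nonstrict X Z X' Z' =
  ¬Absorbs-if-absorber-diverges (nonstrict-discards-Ω X' Z') ev-var
                                (strict-diverges-on-discard-Ω X Z)

proposition7p9 : ∀ (X Y Z X' Y' Z' : Letter) → Y ≢ Y' →
    ¬ Absorbs ⟨ X' , Y' , Z' ⟩ ⟨ X , Y , Z ⟩ × ¬ Absorbs ⟨ X , Y , Z ⟩ ⟨ X' , Y' , Z' ⟩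
proposition7p9 X I Z X' I Z' Y≢Y' = ⊥-elim (Y≢Y' refl)
proposition7p9 X S Z X' S Z' Y≢Y' = ⊥-elim (Y≢Y' refl)
proposition7p9 X I Z X' S Z' _ =
  strict-¬Absorbs-nonstrict X' Z' X Z , nonstrict-¬Absorbs-strict X' Z' X Z
proposition7p9 X S Z X' I Z' _ =
  nonstrict-¬Absorbs-strict X Z X' Z' , strict-¬Absorbs-nonstrict X Z X' Z'
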